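{- Let $[u_\Delta]:\Gamma\to\Delta$ and $[u_\Phi]:\Gamma\to\Phi$ be embeddings of theory presentations, and let $\pi_\Delta:|\Delta|\to\mathcal V$, $\pi_\Phi:|\Phi|\to\mathcal V$ be injective renaming functions such that for all $x\in|\Delta|,y\in|\Phi|$: $\pi_\Delta(x)=\pi_\Phi(y)\iff\exists z\in|\Gamma|.\,x=z[u_\Delta]\wedge y=z[u_\Phi]$. Then $$\mathrm{combine}(u_\Delta,u_\Phi,\pi_\Delta,\pi_\Phi)=\mathrm{combine}(u_\Phi,u_\Delta,\pi_\Phi,\pi_\Delta),$$ i.e. combine is commutative (with the roles of the $\Delta$- and $\Phi$-components of the two resulting records exchanged).
   Context: Fix a dependent type theory with an infinite set $\mathcal V$ of variable names, typing judgements, a definitional-equality judgement, and simultaneous substitution; $e[v]$ denotes applying an assignment $v$ to $e$. A theory presentation is a well-formed list of declarations $x_1:\sigma_1;\dots;x_n:\sigma_n$ with distinct names; $|\Gamma|$ is its set of names. A view $[v]:\Gamma\to\Delta$ assigns to each $a\in|\Gamma|$ (declared $a:\sigma_a$) a term $r_a$ with $\Delta\vdash r_a:\sigma_a[v]$; composition $[v];[w]$ assigns $a\mapsto r_a[w]$; two views are equivalent if their assigned terms are pointwise definitionally equal. An embedding $\tilde\pi:\Gamma\to\Delta$ is the view $x\mapsto\pi(x)$ induced by a finite-support bijection $\pi:\mathcal V\to\mathcal V$ whose inverse restricts to an injection $|\Delta|\to|\Gamma|$; then $\Delta=\Gamma[u]\rtimes\Delta^+$ (the renamed copy of $\Gamma$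 followed by the remaining declarations $\Delta^+$). $\mathrm{combine}(u_\Delta,u_\Phi,\pi_\Delta,\pi_\Phi)$, for $\Delta=\Gamma[u_\Delta]\rtimes\Delta^+$, $\Phi=\Gamma[u_\Phi]\rtimes\Phi^+$, is the record with: $\mathtt{pres}=\Xi:=\Xi_0\rtimes(\Xi_\Delta\cup\Xi_\Phi)$, where $\Xi_0$ is $\Gamma$ with each $z$ renamed to $\pi_\Delta(z[u_\Delta])$, $\Xi_\Delta$ is $\Delta^+$ with names of $\Delta$ renamed by $\pi_\Delta$, $\Xi_\Phi$ is $\Phi^+$ with names of $\Phi$ renamed by $\pi_\Phi$, and $\Xi_0\rtimes(\Xi_\Delta\cup\Xi_\Phi)$ denotes $\Xi_0\rtimes\Xi_\Delta\rtimes\Xi_\Phi$ identified with $\Xi_0\rtimes\Xi_\Phi\rtimes\Xi_\Delta$; $\mathtt{embed}_\Delta=\tilde\pi_\Delta:\Delta\to\Xi$; $\mathtt{embed}_\Phi=\tilde\pi_\Phi:\Phi\to\Xi$; $\mathtt{diag}=[u_\Delta];\tilde\pi_\Delta\;(=[u_\Phi];\tilde\pi_\Phi):\Gamma\to\Xi$; and $\mathtt{mediate}$ sends views $[w_\Delta]:\Delta\to\Omega$, $[w_\Phi]:\Phi\to\Omega$ with $[u_\Delta];[w_\Delta]$ equivalent to $[u_\Phi];[w_\Phi]$ to the view $\Xi\to\Omega$ given by $\pi_\Delta(x)\mapsto x[w_\Delta]$ ($x\in|\Delta|$) and $\pi_\Phi(y)\mapsto y[w_\Phi]$ ($y\in|\Phi|$).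 -}

module Defs where

open import Level using (Level) renaming (suc to lsuc)
open import Data.Nat using (ℕ) renaming (_≟_ to _≟ℕ_)
open import Data.Product using (Σ; ∃; _×_; _,_; proj₁; proj₂; ∃-syntax)
open import Data.Sum using (_⊎_)
open import Data.List using (List; []; _∷_; map; _++_)
open import Data.List.Membership.Propositional using (_∈_; _∉_)
open import Data.List.Membership.DecPropositional _≟ℕ_ using (_∈?_)
open import Data.List.Relation.Unary.Unique.Propositional using (Unique)
open import Data.Maybe using (Maybe; just; nothing)
open import Function using (_∘_)
open import Function.Bundles using (_↔_; Inverse)
open import Relation.Binary.PropositionalEquality using (_≡_)
open import Relation.Nullary using (yes; no)

-- The infinite set of variable names (decidable equality).
V : Set
V = ℕ

record TypeTheory (ℓ : Level) : Set (lsuc ℓ) where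
  infixl 20 _⟦_⟧
  field
    Tm      : Set ℓ
    var     : V → Tm
    _⟦_⟧    : Tm → (V → Tm) → Tm
    var-⟦⟧  : ∀ x v → var x ⟦ v ⟧ ≡ v x
    ⟦⟧-cong : ∀ t {v w : V → Tm} → (∀ x → v x ≡ w x) → t ⟦ v ⟧ ≡ t ⟦ w ⟧
    WF      : List (V × Tm) → Set ℓ
    _⊢_∶_   : List (V × Tm) → Tm → Tm → Set ℓ
    _⊢_≐_   : List (V × Tm) → Tm → Tm → Set ℓ
    ≐-refl  : ∀ Γ t → Γ ⊢ t ≐ t
    ≐-sym   : ∀ {Γ s t} → Γ ⊢ s ≐ t → Γ ⊢ t ≐ s
    ≐-trans : ∀ {Γ s t r} → Γ ⊢ s ≐ t → Γ ⊢ t ≐ r → Γ ⊢ s ≐ r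

module Theory {ℓ : Level} (T : TypeTheory ℓ) where
  open TypeTheory T

  Pres : Set ℓ
  Pres = List (V × Tm)

  names : Pres → List V
  names = map proj₁

  IsPres : Pres → Set ℓ
  IsPres Γ = WF Γ × Unique (names Γ)

  IsView : Pres → Pres → (V → Tm) → Set ℓ
  IsView Γ Δ v = ∀ {a σ} → (a , σ) ∈ Γ → Δ ⊢ v a ∶ (σ ⟦ v ⟧)

  _⨾_ : (V → Tm) → (V → Tm) → V → Tm
  (v ⨾ w) a = v a ⟦ w ⟧

  ViewEquiv : Pres → Pres → (V → Tm) → (V → Tm) → Set ℓ
  ViewEquiv Γ Ω v w = ∀ a → a ∈ names Γ → Ω ⊢ v a ≐ w a

  InjectiveOn : (V → V) → List V → Set
  InjectiveOn f A = ∀ x y → x ∈ A → y ∈ A → f x ≡ f y → x ≡ y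

  renameWith : (V → V) → (V → Tm) → Pres → Pres
  renameWith f s = map (λ d → f (proj₁ d) , proj₂ d ⟦ s ⟧)

  guard : Pres → (V → V) → V → Tm
  guard Γ f z with z ∈? names Γ
  ... | yes _ = var (f z)
  ... | no  _ = var z

  record Embedding (Γ Δ : Pres) : Set ℓ where
    field
      perm    : V ↔ V
    ρ : V → V
    ρ = Inverse.to perm
    u : V → Tm
    u = var ∘ ρ
    field
      support : List V
      finite  : ∀ x → x ∉ support → ρ x ≡ x
      rest    : Pres
      split   : Δ ≡ renameWith ρ u Γ ++ rest
      isView  : IsView Γ Δ u

  findPre : (V → V) → List V → V → Maybe V
  findPre π []       n = nothing
  findPre π (x ∷ xs) n with π x ≟ℕ n
  ... | yes _ = just x
  ... | no  _ = findPre π xs n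

  record Combined : Set ℓ where
    field
      base left right : Pres
      embedΔ embedΦ diag : V → Tm
      mediate : (V → Tm) → (V → Tm) → V → Tm
    pres : Pres
    pres = base ++ left ++ right

  combine : ∀ {Γ Δ Φ} → Embedding Γ Δ → Embedding Γ Φ → (V → V) → (V → V) → Combined
  combine {Γ} {Δ} {Φ} eΔ eΦ πΔ πΦ = record
    { base    = renameWith (πΔ ∘ ρΔ) (guard Γ (πΔ ∘ ρΔ)) Γ
    ; left    = renameWith πΔ (var ∘ πΔ) (Embedding.rest eΔ)
    ; right   = renameWith πΦ (var ∘ πΦ) (Embedding.rest eΦ)
    ; embedΔ  = var ∘ πΔ
    ; embedΦ  = var ∘ πΦ
    ; diag    = Embedding.u eΔ ⨾ (var ∘ πΔ)
    ; mediate = med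
    }
    where
    ρΔ = Embedding.ρ eΔ
    med : (V → Tm) → (V → Tm) → V → Tm
    med wΔ wΦ n with findPre πΔ (names Δ) n
    ... | just x = var x ⟦ wΔ ⟧
    ... | nothing with findPre πΦ (names Φ) n
    ...   | just y  = var y ⟦ wΦ ⟧
    ...   | nothing = var n

  -- Equality of the presentation field, with
  -- Ξ₀ ⋊ Ξ_Δ ⋊ Ξ_Φ identified with Ξ₀ ⋊ Ξ_Φ ⋊ Ξ_Δ.
  PresEq : Combined → Combined → Set ℓ
  PresEq C D = base C ≡ base D
             × ((left C ≡ left D × right C ≡ right D)
               ⊎ (left C ≡ right D × right C ≡ left D))
    where open Combined

  -- Views are compared
  -- on the names of their domain; mediating views up to view equivalence.
  record SwappedEq {Γ Δ Φ : Pres} (eΔ : Embedding Γ Δ) (eΦ : Embedding Γ Φ)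
                   (C D : Combined) : Set (lsuc ℓ) where
    open Combined
    field
      pres≡    : PresEq C D
      embedΔ≡  : ∀ x → x ∈ names Δ → embedΔ C x ≡ embedΦ D x
      embedΦ≡  : ∀ y → y ∈ names Φ → embedΦ C y ≡ embedΔ D y
      diag≡    : ∀ z → z ∈ names Γ → diag C z ≡ diag D z
      mediate≡ : ∀ (Ω : Pres) → IsPres Ω → (wΔ wΦ : V → Tm)
               → IsView Δ Ω wΔ → IsView Φ Ω wΦ
               → ViewEquiv Γ Ω (Embedding.u eΔ ⨾ wΔ) (Embedding.u eΦ ⨾ wΦ)
               → ViewEquiv (pres C) Ω (mediate C wΔ wΦ) (mediate D wΦ wΔ)

module Submission where

-- Both records combine(eΔ,eΦ,πΔ,πΦ) and combine(eΦ,eΔ,πΦ,πΔ) are built from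
-- the same pieces, so most fields agree on the nose: the two embeddings are
-- literally exchanged, and the left/right parts of the presentation are
-- exchanged (which PresEq permits).  Only two facts carry content.
--
--  * The glued renamings agree on the shared part: for z ∈ |Γ| the names
--    ρΔ z and ρΦ z lie in |Δ| and |Φ| and are identified by the gluing
--    condition, so πΔ (ρΔ z) ≡ πΦ (ρΦ z).  This yields equality of the base
--    presentations Ξ₀ and of the diagonal views.
--
--  * The two mediating views differ only in which side they look up first;
--    if a name has preimages x ∈ |Δ| and y ∈ |Φ| at once, the gluing
--    condition makes them images of a common z ∈ |Γ|, where wΔ and wΦ agree
--    up to definitional equality by the compatibility hypothesis.

open import Defs
open import Level using (Level)
open import Data.Nat using () renaming (_≟_ to _≟ℕ_)
open import Data.Product using (_×_; ∃-syntax; _,_; proj₁; proj₂)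
open import Data.Sum using (inj₂)
open import Data.List using ([]; _∷_; _++_; map)
open import Data.List.Properties using (map-++)
open import Data.List.Relation.Unary.Any using (here; there)
open import Data.List.Membership.Propositional using (_∈_)
open import Data.List.Membership.Propositional.Properties using (∈-map⁺; ∈-++⁺ˡ)
open import Data.List.Membership.DecPropositional _≟ℕ_ using (_∈?_)
open import Data.Maybe using (just; nothing)
open import Function using (_∘_)
open import Relation.Binary.PropositionalEquality
  using (_≡_; refl; sym; trans; cong; cong₂; subst; module ≡-Reasoning)
open import Relation.Nullary using (yes; no)

module CombineLemmas {ℓ : Level} (T : TypeTheory ℓ) where
  open TypeTheory T
  open Theory T

  names-renameWith : ∀ (f : V → V) (s : V → Tm) (L : Pres) →
    names (renameWith f s L) ≡ map f (names L)
  names-renameWith f s []      = refl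
  names-renameWith f s (d ∷ L) = cong (f _ ∷_) (names-renameWith f s L)

  -- An embedding Γ → Δ sends names of Γ to names of Δ, since Δ = Γ[u] ⋊ Δ⁺.
  ∈-embedding : ∀ {Γ Δ} (e : Embedding Γ Δ) {z} → z ∈ names Γ →
    Embedding.ρ e z ∈ names Δ
  ∈-embedding {Γ} e {z} z∈Γ =
    subst (λ D → ρ z ∈ names D) (sym split) ρz∈Γ[u]⋊Δ⁺
    where
    open Embedding e
    ρz∈Γ[u] : ρ z ∈ names (renameWith ρ u Γ)
    ρz∈Γ[u] = subst (ρ z ∈_) (sym (names-renameWith ρ u Γ)) (∈-map⁺ ρ z∈Γ)
    ρz∈Γ[u]⋊Δ⁺ : ρ z ∈ names (renameWith ρ u Γ ++ rest)
    ρz∈Γ[u]⋊Δ⁺ = subst (ρ z ∈_) (sym (map-++ _ (renameWith ρ u Γ) rest))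
                        (∈-++⁺ˡ ρz∈Γ[u])

  renameWith-cong : ∀ {f g : V → V} {s t : V → Tm} (L : Pres) →
    (∀ z → z ∈ names L → f z ≡ g z) → (∀ x → s x ≡ t x) →
    renameWith f s L ≡ renameWith g t L
  renameWith-cong []            f≗g s≗t = refl
  renameWith-cong ((a , σ) ∷ L) f≗g s≗t =
    cong₂ _∷_ (cong₂ _,_ (f≗g a (here refl)) (⟦⟧-cong σ s≗t))
              (renameWith-cong L (λ z z∈L → f≗g z (there z∈L)) s≗t)

  guard-cong : ∀ (Γ : Pres) {f g : V → V} → (∀ z → z ∈ names Γ → f z ≡ g z) →
    ∀ x → guard Γ f x ≡ guard Γ g x
  guard-cong Γ f≗g x with x ∈? names Γ
  ... | yes x∈Γ = cong var (f≗g x x∈Γ)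
  ... | no  _   = refl

  findPre-sound : ∀ (π : V → V) xs {n x} → findPre π xs n ≡ just x →
    x ∈ xs × π x ≡ n
  findPre-sound π (y ∷ xs) {n} found with π y ≟ℕ n
  findPre-sound π (y ∷ xs) refl | yes πy≡n = here refl , πy≡n
  ... | no _ with findPre-sound π xs found
  ... | x∈xs , πx≡n = there x∈xs , πx≡n

  SharedOrigin : ∀ {Γ Δ Φ} → Embedding Γ Δ → Embedding Γ Φ → V → V → Set
  SharedOrigin {Γ} eΔ eΦ x y =
    ∃[ z ] (z ∈ names Γ × x ≡ Embedding.ρ eΔ z × y ≡ Embedding.ρ eΦ z)

  glued-on-Γ : ∀ {Γ Δ Φ} (eΔ : Embedding Γ Δ) (eΦ : Embedding Γ Φ) {πΔ πΦ : V → V} →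
    (∀ x y → x ∈ names Δ → y ∈ names Φ → SharedOrigin eΔ eΦ x y → πΔ x ≡ πΦ y) →
    ∀ z → z ∈ names Γ → πΔ (Embedding.ρ eΔ z) ≡ πΦ (Embedding.ρ eΦ z)
  glued-on-Γ eΔ eΦ identify z z∈Γ =
    identify _ _ (∈-embedding eΔ z∈Γ) (∈-embedding eΦ z∈Γ) (z , z∈Γ , refl , refl)

  diag-glued : ∀ {Γ Δ Φ} (eΔ : Embedding Γ Δ) (eΦ : Embedding Γ Φ) {πΔ πΦ : V → V} →
    (∀ z → z ∈ names Γ → πΔ (Embedding.ρ eΔ z) ≡ πΦ (Embedding.ρ eΦ z)) →
    ∀ z → z ∈ names Γ →
    (Embedding.u eΔ ⨾ (var ∘ πΔ)) z ≡ (Embedding.u eΦ ⨾ (var ∘ πΦ)) z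
  diag-glued eΔ eΦ {πΔ} {πΦ} agree z z∈Γ = begin
    var (ρΔ z) ⟦ var ∘ πΔ ⟧   ≡⟨ var-⟦⟧ _ _ ⟩
    var (πΔ (ρΔ z))           ≡⟨ cong var (agree z z∈Γ) ⟩
    var (πΦ (ρΦ z))           ≡⟨ sym (var-⟦⟧ _ _) ⟩
    var (ρΦ z) ⟦ var ∘ πΦ ⟧   ∎
    where
    open ≡-Reasoning
    ρΔ ρΦ : V → V
    ρΔ = Embedding.ρ eΔ
    ρΦ = Embedding.ρ eΦ

  clash-resolved : ∀ {Γ Δ Φ} (eΔ : Embedding Γ Δ) (eΦ : Embedding Γ Φ) {πΔ πΦ : V → V} →
    (∀ x y → x ∈ names Δ → y ∈ names Φ → πΔ x ≡ πΦ y → SharedOrigin eΔ eΦ x y) →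
    ∀ Ω (wΔ wΦ : V → Tm) →
    ViewEquiv Γ Ω (Embedding.u eΔ ⨾ wΔ) (Embedding.u eΦ ⨾ wΦ) →
    ∀ x y → x ∈ names Δ → y ∈ names Φ → πΔ x ≡ πΦ y →
    Ω ⊢ (var x ⟦ wΔ ⟧) ≐ (var y ⟦ wΦ ⟧)
  clash-resolved eΔ eΦ separated Ω wΔ wΦ compatible x y x∈Δ y∈Φ πΔx≡πΦy
    with separated x y x∈Δ y∈Φ πΔx≡πΦy
  ... | z , z∈Γ , refl , refl = compatible z z∈Γ

  mediate-swap : ∀ {Γ Δ Φ} (eΔ : Embedding Γ Δ) (eΦ : Embedding Γ Φ) (πΔ πΦ : V → V)
    (Ω : Pres) (wΔ wΦ : V → Tm) →
    (∀ x y → x ∈ names Δ → y ∈ names Φ → πΔ x ≡ πΦ y →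
       Ω ⊢ (var x ⟦ wΔ ⟧) ≐ (var y ⟦ wΦ ⟧)) →
    ∀ n → Ω ⊢ Combined.mediate (combine eΔ eΦ πΔ πΦ) wΔ wΦ n
            ≐ Combined.mediate (combine eΦ eΔ πΦ πΔ) wΦ wΔ n
  mediate-swap {Δ = Δ} {Φ} eΔ eΦ πΔ πΦ Ω wΔ wΦ clash n
    with findPre πΔ (names Δ) n in foundΔ | findPre πΦ (names Φ) n in foundΦ
  ... | just x  | just y  with findPre-sound πΔ _ foundΔ | findPre-sound πΦ _ foundΦ
  ...   | x∈Δ , πΔx≡n | y∈Φ , πΦy≡n =
          clash x y x∈Δ y∈Φ (trans πΔx≡n (sym πΦy≡n))
  mediate-swap eΔ eΦ πΔ πΦ Ω wΔ wΦ clash n | just x  | nothing rewrite foundΔ = ≐-refl Ω _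
  mediate-swap eΔ eΦ πΔ πΦ Ω wΔ wΦ clash n | nothing | just y  rewrite foundΦ = ≐-refl Ω _
  mediate-swap eΔ eΦ πΔ πΦ Ω wΔ wΦ clash n | nothing | nothing
    rewrite foundΔ | foundΦ = ≐-refl Ω _

proposition1 : ∀ {ℓ : Level} (T : TypeTheory ℓ) → let open Theory T in
    (Γ Δ Φ : Pres) → IsPres Γ → IsPres Δ → IsPres Φ →
    (eΔ : Embedding Γ Δ) (eΦ : Embedding Γ Φ) (πΔ πΦ : V → V) →
    InjectiveOn πΔ (names Δ) → InjectiveOn πΦ (names Φ) →
    (∀ x y → x ∈ names Δ → y ∈ names Φ →
    (πΔ x ≡ πΦ y → ∃[ z ] (z ∈ names Γ × x ≡ Embedding.ρ eΔ z × y ≡ Embedding.ρ eΦ z))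
    × (∃[ z ] (z ∈ names Γ × x ≡ Embedding.ρ eΔ z × y ≡ Embedding.ρ eΦ z) → πΔ x ≡ πΦ y)) →
    SwappedEq eΔ eΦ (combine eΔ eΦ πΔ πΦ) (combine eΦ eΔ πΦ πΔ)
proposition1 T Γ Δ Φ _ _ _ eΔ eΦ πΔ πΦ _ _ gluing = record
  { pres≡    = renameWith-cong Γ agree (guard-cong Γ agree) , inj₂ (refl , refl)
  ; embedΔ≡  = λ _ _ → refl
  ; embedΦ≡  = λ _ _ → refl
  ; diag≡    = diag-glued eΔ eΦ agree
  ; mediate≡ = λ Ω _ wΔ wΦ _ _ compatible n _ →
      mediate-swap eΔ eΦ πΔ πΦ Ω wΔ wΦ
        (clash-resolved eΔ eΦ separated Ω wΔ wΦ compatible) n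
  }
  where
  open Theory T
  open CombineLemmas T

  separated : ∀ x y → x ∈ names Δ → y ∈ names Φ → πΔ x ≡ πΦ y →
    SharedOrigin eΔ eΦ x y
  separated x y x∈Δ y∈Φ = proj₁ (gluing x y x∈Δ y∈Φ)

  agree : ∀ z → z ∈ names Γ → πΔ (Embedding.ρ eΔ z) ≡ πΦ (Embedding.ρ eΦ z)
  agree = glued-on-Γ eΔ eΦ (λ x y x∈Δ y∈Φ → proj₂ (gluing x y x∈Δ y∈Φ))
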